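{- Let $\widehat{X}$ be a sink-distance-regular directed graph with parameters $d\ge1$, $\{a_i\},\{b_i\},\{c_i\}$ and sink-neighborhoods $\Gamma_0,\dots,\Gamma_d$. Let $1\le i\le d$ and let $x$ be a configuration in which each vertex of $\Gamma_i$ holds at least $\deg^{+}(\Gamma_i)$ grains and, for every $j$ with $i<j\le d$, each vertex of $\Gamma_j$ holds at least $\deg^{+}(\Gamma_j)-c_j$ grains. Then $U_i=T_dT_{d-1}\cdots T_{i+1}T_i$ is a legal sequence of topplings to apply to $x$, and $$U_i(x)=x+b_{i-1}\gamma_{i-1}-c_i\gamma_i\quad\text{if }1<i\le d,\qquad U_1(x)=x-c_1\gamma_1.$$
   Context: Let $\widehat X$ be a finite directed multigraph (loops and multiple edges allowed) with a distinguished sink vertex $s$ reachable from all vertices and at least one non-sink vertex. Grains of sand sit on non-sink vertices; toppling a vertex $v$ holding at least $\deg^{+}(v)$ (out-degree) grains sends one grain along each out-edge (grains reaching the sink vanish); a sequence of topplings is legal if each vertex, at the moment it topples, holds at least its out-degree in grains. For vertices $x,y$, $\delta(x,y)$ is the length of a shortest directed path from $x$ to $y$; $\Gamma_i=\{x:\delta(x,s)=i\}$ and $d=\max_x\delta(x,s)$. $\widehat X$ is sink-distance-regular if the sink has out-degree $0$, every edge with tail in $\Gamma_i$ has head in $\Gamma_{i-1}\cup\Gamma_i\cup\Gamma_{i+1}$ ($\Gamma_{d+1}=\emptyset$), and there are nonnegative integers $a_1,\dots,a_d$ and positive integers $b_1,\dots,b_{d-1}$, $c_1,\dots,c_d$ (with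 $b_d:=0$) such that: each $v\in\Gamma_1$ is the tail of exactly $c_1$ edges with head the sink; each $v\in\Gamma_i$, $i>1$, is the tail of exactly $c_i$ edges with heads in $\Gamma_{i-1}$ and the head of exactly $c_i$ edges with tails in $\Gamma_{i-1}$; and each $v\in\Gamma_i$, $i\ge1$, is the tail of exactly $a_i$ edges with heads in $\Gamma_i$, the head of exactly $a_i$ edges with tails in $\Gamma_i$, the tail of exactly $b_i$ edges with heads in $\Gamma_{i+1}$, and the head of exactly $b_i$ edges with tails in $\Gamma_{i+1}$. Then every $v\in\Gamma_i$ ($i\ge1$) has out-degree $\deg^{+}(\Gamma_i):=a_i+b_i+c_i$. $\gamma_i$ is the configuration with one grain on each vertex of $\Gamma_i$ and none elsewhere (sums and integer multiples of configurations are pointwise). $T_i$ is the operation of toppling each vertex of $\Gamma_i$ exactly once, and $U_i=T_dT_{d-1}\cdots T_i$ (apply $T_i$ first), with $U_d=T_d$. -}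

module Defs where

open import Data.Nat as ℕ using (ℕ; zero; suc; _≤_; _<_; _≡ᵇ_)
open import Data.Integer as ℤ using (ℤ; +_)
open import Data.Fin using (Fin; _≟_)
open import Data.Bool using (Bool; true; false; if_then_else_)
open import Data.Nat.ListAction using (sum)
open import Data.List using (List; []; _∷_; map; allFin; filterᵇ; concat; upTo)
open import Data.Product using (_×_; Σ; ∃)
open import Data.Unit using (⊤)
open import Relation.Nullary using (¬_; does)
open import Relation.Binary.PropositionalEquality using (_≡_)

-- A finite directed multigraph on vertex set Fin n is given by the edge
-- multiplicity function E : E u w = number of edges with tail u and head w.
Mult : ℕ → Set
Mult n = Fin n → Fin n → ℕ

module _ {n : ℕ} (E : Mult n) where

  outdeg : Fin n → ℕ
  outdeg v = sum (map (E v) (allFin n))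

  data Walk : Fin n → Fin n → ℕ → Set where
    here : ∀ {v} → Walk v v 0
    step : ∀ {u w v k} → 0 < E u w → Walk w v k → Walk u v (suc k)

  Dist : Fin n → Fin n → ℕ → Set
  Dist u v k = Walk u v k × (∀ m → m < k → ¬ Walk u v m)

  outTo : (Fin n → ℕ) → Fin n → ℕ → ℕ
  outTo ℓ v j = sum (map (λ w → if ℓ w ≡ᵇ j then E v w else 0) (allFin n))

  inFrom : (Fin n → ℕ) → Fin n → ℕ → ℕ
  inFrom ℓ v j = sum (map (λ w → if ℓ w ≡ᵇ j then E w v else 0) (allFin n))

  -- ℓ is the sink distance function v ↦ δ(v , s), so Γ_i = { v | ℓ v ≡ i }.
  record SinkDistanceRegular (s : Fin n) (ℓ : Fin n → ℕ) (d : ℕ)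
                             (a b c : ℕ → ℕ) : Set where
    field
      dist      : ∀ v → Dist v s (ℓ v)
      d-max     : ∀ v → ℓ v ≤ d
      d-attain  : ∃ λ v → ℓ v ≡ d
      sink-out  : outdeg s ≡ 0
      edge-near : ∀ u w → 0 < E u w → ℓ u ≤ suc (ℓ w) × ℓ w ≤ suc (ℓ u)
      b-pos     : ∀ j → 1 ≤ j → j < d → 0 < b j
      c-pos     : ∀ j → 1 ≤ j → j ≤ d → 0 < c j
      b-d       : b d ≡ 0
      c-one     : ∀ v → ℓ v ≡ 1 → outTo ℓ v 0 ≡ c 1
      c-out     : ∀ v i → ℓ v ≡ suc i → 1 ≤ i → outTo ℓ v i ≡ c (suc i)
      c-in      : ∀ v i → ℓ v ≡ suc i → 1 ≤ i → inFrom ℓ v i ≡ c (suc i)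
      a-out     : ∀ v i → ℓ v ≡ i → 1 ≤ i → outTo ℓ v i ≡ a i
      a-in      : ∀ v i → ℓ v ≡ i → 1 ≤ i → inFrom ℓ v i ≡ a i
      b-out     : ∀ v i → ℓ v ≡ i → 1 ≤ i → outTo ℓ v (suc i) ≡ b i
      b-in      : ∀ v i → ℓ v ≡ i → 1 ≤ i → inFrom ℓ v (suc i) ≡ b i

  -- configurations: integer-valued (the value at the sink is irrelevant and
  -- is left untouched by toppling: grains reaching the sink vanish)
  Config : Set
  Config = Fin n → ℤ

  topple : Fin n → Fin n → Config → Config
  topple s v x w with does (w ≟ s) | does (w ≟ v)
  ... | true  | _     = x w
  ... | false | true  = x w ℤ.+ + E v w ℤ.- + outdeg v
  ... | false | false = x w ℤ.+ + E v w

  run : Fin n → List (Fin n) → Config → Config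
  run s []       x = x
  run s (v ∷ vs) x = run s vs (topple s v x)

  Legal : Fin n → List (Fin n) → Config → Set
  Legal s []       x = ⊤
  Legal s (v ∷ vs) x = (+ outdeg v ℤ.≤ x v) × Legal s vs (topple s v x)

layer : ∀ {n} → (Fin n → ℕ) → ℕ → List (Fin n)
layer {n} ℓ j = filterᵇ (λ v → ℓ v ≡ᵇ j) (allFin n)

range : ℕ → ℕ → List ℕ
range i d = map (i ℕ.+_) (upTo (suc (d ℕ.∸ i)))

-- U_i = T_d ⋯ T_i as a toppling sequence, where σ j is the enumeration of
-- Γ_j used for T_j (T_i applied first)
U : ∀ {n} → (ℕ → List (Fin n)) → ℕ → ℕ → List (Fin n)
U σ i d = concat (map σ (range i d))

γ : ∀ {n} → (Fin n → ℕ) → ℕ → Fin n → ℤ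
γ ℓ j w = if ℓ w ≡ᵇ j then + 1 else + 0

-- Toppling every vertex of Γ_j once changes a vertex w ≠ s by its in-flow from Γ_j, minus its
-- out-degree if w ∈ Γ_j.  Since edges only join equal or adjacent layers, with the multiplicities
-- a, b, c, this change is transfer_j − transfer_(j+1), where transfer_j = b_(j-1) γ_(j-1) − c_j γ_j
-- is the net flow of grains from Γ_j down to Γ_(j-1).  So U_i = T_d ⋯ T_i telescopes to
-- x + transfer_i, as transfer_(d+1) = 0 (b_d = 0 and Γ_(d+1) = ∅); for i = 1, γ_0 vanishes off
-- the sink.  Legality: within T_j a vertex only gains grains before it topples, T_j hands each
-- vertex of Γ_(j+1) exactly the c_(j+1) grains the hypothesis allows it to lack, and higher
-- layers only gain.

module Submission where

open import Defs
open import Data.Nat as ℕ using (ℕ; zero; suc; _≤_; _<_; _≡ᵇ_; z≤n; s≤s)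
import Data.Nat.Properties as ℕₚ
open import Data.Integer as ℤ using (ℤ; +_)
import Data.Integer.Properties as ℤₚ
open import Data.Integer.Tactic.RingSolver using (solve-∀)
open import Data.Fin using (Fin; _≟_) renaming (zero to fzero; suc to fsuc)
open import Data.Bool using (Bool; true; false; if_then_else_)
open import Data.Nat.ListAction using (sum)
open import Data.Nat.ListAction.Properties using (sum-↭)
open import Data.List using (List; []; _∷_; _++_; map; allFin; filterᵇ; concat; upTo; applyUpTo)
open import Data.List.Properties using (map-cong; map-∘; map-tabulate; map-upTo; ++-identityʳ)
open import Data.List.Relation.Unary.All as All using (All; []; _∷_)
open import Data.List.Relation.Unary.All.Properties using (all-filter)
open import Data.List.Relation.Unary.AllPairs using (_∷_)
open import Data.List.Relation.Unary.Unique.Propositional using (Unique)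
import Data.List.Relation.Unary.Unique.Propositional.Properties as Uniqueₚ
open import Data.List.Relation.Binary.Permutation.Propositional using (_↭_; ↭-sym; ↭⇒↭ₛ)
open import Data.List.Relation.Binary.Permutation.Propositional.Properties using (All-resp-↭; map⁺)
import Data.List.Relation.Binary.Permutation.Setoid.Properties as Permₛ
open import Data.Product using (_×_; _,_; proj₁; proj₂)
open import Data.Sum using (_⊎_; inj₁; inj₂)
import Data.Sum as Sum
open import Data.Empty using (⊥-elim)
open import Data.Unit using (tt)
open import Function using (_∘_)
open import Relation.Nullary using (does; yes; no)
open import Relation.Nullary.Decidable using (dec-true; dec-false; T?)
open import Relation.Binary.PropositionalEquality
  using (_≡_; _≢_; refl; sym; trans; cong; cong₂; subst; setoid; module ≡-Reasoning)
open import Algebra.Properties.CommutativeSemigroup ℕₚ.+-commutativeSemigroup using (interchange)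

≡ᵇ-true : ∀ {m n} → m ≡ n → (m ≡ᵇ n) ≡ true
≡ᵇ-true {m} {n} = dec-true (m ℕₚ.≟ n)

≡ᵇ-false : ∀ {m n} → m ≢ n → (m ≡ᵇ n) ≡ false
≡ᵇ-false {m} {n} = dec-false (m ℕₚ.≟ n)

if-0 : ∀ b → (if b then 0 else 0) ≡ 0
if-0 true  = refl
if-0 false = refl

if-swap : ∀ b b′ (e : ℕ) →
  (if b then (if b′ then e else 0) else 0) ≡ (if b′ then (if b then e else 0) else 0)
if-swap true  true  e = refl
if-swap true  false e = refl
if-swap false true  e = refl
if-swap false false e = refl

between : ∀ {p k} → p ≤ k → k ≤ suc (suc p) → k ≡ p ⊎ k ≡ suc p ⊎ k ≡ suc (suc p)
between {zero} {zero}                _       _                 = inj₁ refl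
between {zero} {suc zero}            _       _                 = inj₂ (inj₁ refl)
between {zero} {suc (suc zero)}      _       _                 = inj₂ (inj₂ refl)
between {zero} {suc (suc (suc _))}   _       (s≤s (s≤s ()))
between {suc _} {suc _}              (s≤s h) (s≤s h′) =
  Sum.map (cong suc) (Sum.map (cong suc) (cong suc)) (between h h′)

split-by-key : ∀ {p} k e → (0 < e → k ≡ p ⊎ k ≡ suc p ⊎ k ≡ suc (suc p)) →
  e ≡ (if k ≡ᵇ p then e else 0) ℕ.+ (if k ≡ᵇ suc p then e else 0) ℕ.+ (if k ≡ᵇ suc (suc p) then e else 0)
split-by-key {p} k zero _
  rewrite if-0 (k ≡ᵇ p) | if-0 (k ≡ᵇ suc p) | if-0 (k ≡ᵇ suc (suc p)) = refl
split-by-key {p} k (suc e) key with key (s≤s z≤n)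
... | inj₁ refl
  rewrite ≡ᵇ-true {p} refl | ≡ᵇ-false {p} {suc p} (ℕₚ.1+n≢n ∘ sym) | ≡ᵇ-false (ℕₚ.m≢1+n+m p {1}) =
  sym (trans (ℕₚ.+-identityʳ _) (ℕₚ.+-identityʳ _))
... | inj₂ (inj₁ refl)
  rewrite ≡ᵇ-false (ℕₚ.1+n≢n {p}) | ≡ᵇ-true {suc p} refl | ≡ᵇ-false {suc p} {suc (suc p)} (ℕₚ.1+n≢n ∘ sym) =
  sym (ℕₚ.+-identityʳ _)
... | inj₂ (inj₂ refl)
  rewrite ≡ᵇ-false (ℕₚ.m≢1+n+m p {1} ∘ sym) | ≡ᵇ-false (ℕₚ.1+n≢n {suc p}) | ≡ᵇ-true {suc (suc p)} refl =
  refl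

module _ {n : ℕ} (ℓ : Fin n → ℕ) where

  γ-on : ∀ {w j} → ℓ w ≡ j → γ ℓ j w ≡ + 1
  γ-on ℓw≡j = cong (if_then + 1 else + 0) (≡ᵇ-true ℓw≡j)

  γ-off : ∀ {w j} → ℓ w ≢ j → γ ℓ j w ≡ + 0
  γ-off ℓw≢j = cong (if_then + 1 else + 0) (≡ᵇ-false ℓw≢j)

module _ {A : Set} where

  sum-map-+ : ∀ (f g : A → ℕ) xs →
    sum (map (λ u → f u ℕ.+ g u) xs) ≡ sum (map f xs) ℕ.+ sum (map g xs)
  sum-map-+ f g []       = refl
  sum-map-+ f g (u ∷ xs) = trans (cong (f u ℕ.+ g u ℕ.+_) (sum-map-+ f g xs)) (interchange (f u) (g u) _ _)

  sum-map-zero : ∀ (f : A → ℕ) xs → (∀ u → f u ≡ 0) → sum (map f xs) ≡ 0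
  sum-map-zero f []       _    = refl
  sum-map-zero f (u ∷ xs) f≡0 = cong₂ ℕ._+_ (f≡0 u) (sum-map-zero f xs f≡0)

  sum-map-filterᵇ : ∀ (p : A → Bool) (f : A → ℕ) xs →
    sum (map f (filterᵇ p xs)) ≡ sum (map (λ u → if p u then f u else 0) xs)
  sum-map-filterᵇ p f []       = refl
  sum-map-filterᵇ p f (u ∷ xs) with p u
  ... | true  = cong (f u ℕ.+_) (sum-map-filterᵇ p f xs)
  ... | false = sum-map-filterᵇ p f xs

sum-allFin-suc : ∀ {n} (g : Fin (suc n) → ℕ) →
  sum (map g (allFin (suc n))) ≡ g fzero ℕ.+ sum (map (g ∘ fsuc) (allFin n))
sum-allFin-suc g = cong (g fzero ℕ.+_) (cong sum (trans (map-tabulate fsuc g) (sym (map-tabulate (λ v → v) (g ∘ fsuc)))))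

sum-allFin-indicator : ∀ {n} (f : Fin n → ℕ) w →
  sum (map (λ v → if does (w ≟ v) then f v else 0) (allFin n)) ≡ f w
sum-allFin-indicator {suc n} f fzero =
  trans (sum-allFin-suc (λ v → if does (fzero ≟ v) then f v else 0))
    (trans (cong (f fzero ℕ.+_) (sum-map-zero _ (allFin n) (λ _ → refl))) (ℕₚ.+-identityʳ _))
sum-allFin-indicator {suc n} f (fsuc w) =
  trans (sum-allFin-suc (λ v → if does (fsuc w ≟ v) then f v else 0)) (sum-allFin-indicator (f ∘ fsuc) w)

module Toppling {n : ℕ} (E : Mult n) (s : Fin n) where

  inflow : List (Fin n) → Fin n → ℕ
  inflow vs w = sum (map (λ v → E v w) vs)

  outflow : List (Fin n) → Fin n → ℕ
  outflow vs w = sum (map (λ v → if does (w ≟ v) then outdeg E v else 0) vs)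

  topple-≢sink : ∀ v x w → w ≢ s →
    topple E s v x w ≡ x w ℤ.+ + E v w ℤ.- + (if does (w ≟ v) then outdeg E v else 0)
  topple-≢sink v x w w≢s with w ≟ s
  ... | yes w≡s = ⊥-elim (w≢s w≡s)
  ... | no _ with w ≟ v
  ...   | yes _ = refl
  ...   | no _  = sym (ℤₚ.+-identityʳ _)

  run-≢sink : ∀ vs x w → w ≢ s → run E s vs x w ≡ x w ℤ.+ + inflow vs w ℤ.- + outflow vs w
  run-≢sink []       x w w≢s = sym (trans (ℤₚ.+-identityʳ _) (ℤₚ.+-identityʳ _))
  run-≢sink (v ∷ vs) x w w≢s = begin
    run E s vs (topple E s v x) w
      ≡⟨ run-≢sink vs (topple E s v x) w w≢s ⟩
    topple E s v x w ℤ.+ + inflow vs w ℤ.- + outflow vs w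
      ≡⟨ cong (λ t → t ℤ.+ + inflow vs w ℤ.- + outflow vs w) (topple-≢sink v x w w≢s) ⟩
    x w ℤ.+ + E v w ℤ.- + lost ℤ.+ + inflow vs w ℤ.- + outflow vs w
      ≡⟨ regroup (x w) (+ E v w) (+ lost) (+ inflow vs w) (+ outflow vs w) ⟩
    x w ℤ.+ (+ E v w ℤ.+ + inflow vs w) ℤ.- (+ lost ℤ.+ + outflow vs w)
      ≡⟨ sym (cong₂ (λ i o → x w ℤ.+ i ℤ.- o) (ℤₚ.pos-+ (E v w) _) (ℤₚ.pos-+ lost _)) ⟩
    x w ℤ.+ + inflow (v ∷ vs) w ℤ.- + outflow (v ∷ vs) w ∎
    where
    open ≡-Reasoning
    lost = if does (w ≟ v) then outdeg E v else 0
    regroup : ∀ x e l i o → x ℤ.+ e ℤ.- l ℤ.+ i ℤ.- o ≡ x ℤ.+ (e ℤ.+ i) ℤ.- (l ℤ.+ o)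
    regroup = solve-∀

  run-++ : ∀ us vs x → run E s (us ++ vs) x ≡ run E s vs (run E s us x)
  run-++ []       vs x = refl
  run-++ (u ∷ us) vs x = run-++ us vs (topple E s u x)

  Legal-++ : ∀ us vs x → Legal E s us x → Legal E s vs (run E s us x) → Legal E s (us ++ vs) x
  Legal-++ []       vs x _              legal-vs = legal-vs
  Legal-++ (u ∷ us) vs x (ready , legal-us) legal-vs = ready , Legal-++ us vs (topple E s u x) legal-us legal-vs

  topple-other-≥ : ∀ v x u → u ≢ v → x u ℤ.≤ topple E s v x u
  topple-other-≥ v x u u≢v with u ≟ s
  ... | yes _ = ℤₚ.≤-refl
  ... | no _ with u ≟ v
  ...   | yes u≡v = ⊥-elim (u≢v u≡v)
  ...   | no _    = ℤₚ.i≤i+j (x u) (+ E v u)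

  Legal-unique : ∀ vs x → Unique vs → All (λ v → + outdeg E v ℤ.≤ x v) vs → Legal E s vs x
  Legal-unique []       x _                  _               = tt
  Legal-unique (v ∷ vs) x (v∉vs ∷ unique) (ready ∷ readies) =
    ready , Legal-unique vs (topple E s v x) unique (still-ready v∉vs readies)
    where
    still-ready : ∀ {us} → All (v ≢_) us → All (λ u → + outdeg E u ℤ.≤ x u) us →
      All (λ u → + outdeg E u ℤ.≤ topple E s v x u) us
    still-ready []           []         = []
    still-ready (v≢u ∷ v∉us) (r ∷ rs) = ℤₚ.≤-trans r (topple-other-≥ v x _ (v≢u ∘ sym)) ∷ still-ready v∉us rs

module Regularity {n : ℕ} {E : Mult n} {s : Fin n} {ℓ : Fin n → ℕ} {d : ℕ} {a b c : ℕ → ℕ}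
                  (R : SinkDistanceRegular E s ℓ d a b c) where
  open SinkDistanceRegular R

  ℓ≡0⇒≡sink : ∀ {w} → ℓ w ≡ 0 → w ≡ s
  ℓ≡0⇒≡sink {w} ℓw≡0 with subst (λ k → Walk E w s k) ℓw≡0 (proj₁ (dist w))
  ... | here = refl

  ℓ-sink : ℓ s ≡ 0
  ℓ-sink with ℓ s | dist s
  ... | zero  | _                 = refl
  ... | suc _ | (_ , no-shorter) = ⊥-elim (no-shorter 0 (s≤s z≤n) here)

  0<ℓ⇒≢sink : ∀ {w} → 0 < ℓ w → w ≢ s
  0<ℓ⇒≢sink pos w≡s = ℕₚ.<⇒≢ pos (sym (trans (cong ℓ w≡s) ℓ-sink))

  edge-layers : ∀ {u w p} → ℓ u ≡ suc p → 0 < E u w → ℓ w ≡ p ⊎ ℓ w ≡ suc p ⊎ ℓ w ≡ suc (suc p)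
  edge-layers {u} {w} ℓu≡ edge with edge-near u w edge
  ... | up , down = between (ℕ.s≤s⁻¹ (subst (_≤ suc (ℓ w)) ℓu≡ up)) (subst (λ k → ℓ w ≤ suc k) ℓu≡ down)

  outTo-below : ∀ {w p} → ℓ w ≡ suc p → outTo E ℓ w p ≡ c (suc p)
  outTo-below {w} {zero}  ℓw≡ = c-one w ℓw≡
  outTo-below {w} {suc q} ℓw≡ = c-out w (suc q) ℓw≡ (s≤s z≤n)

  outdeg-layer : ∀ {w p} → ℓ w ≡ suc p → outdeg E w ≡ c (suc p) ℕ.+ a (suc p) ℕ.+ b (suc p)
  outdeg-layer {w} {p} ℓw≡ = begin
    outdeg E w
      ≡⟨ cong sum (map-cong (λ u → split-by-key (ℓ u) (E w u) (edge-layers ℓw≡)) (allFin n)) ⟩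
    sum (map (λ u → to p u ℕ.+ to (suc p) u ℕ.+ to (suc (suc p)) u) (allFin n))
      ≡⟨ sum-map-+ _ (to (suc (suc p))) (allFin n) ⟩
    sum (map (λ u → to p u ℕ.+ to (suc p) u) (allFin n)) ℕ.+ outTo E ℓ w (suc (suc p))
      ≡⟨ cong (ℕ._+ outTo E ℓ w (suc (suc p))) (sum-map-+ (to p) (to (suc p)) (allFin n)) ⟩
    outTo E ℓ w p ℕ.+ outTo E ℓ w (suc p) ℕ.+ outTo E ℓ w (suc (suc p))
      ≡⟨ cong₂ ℕ._+_ (cong₂ ℕ._+_ (outTo-below ℓw≡) (a-out w (suc p) ℓw≡ (s≤s z≤n))) (b-out w (suc p) ℓw≡ (s≤s z≤n)) ⟩
    c (suc p) ℕ.+ a (suc p) ℕ.+ b (suc p) ∎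
    where
    open ≡-Reasoning
    to : ℕ → Fin n → ℕ
    to j u = if ℓ u ≡ᵇ j then E w u else 0

  inFrom-far : ∀ {w p} → ℓ w ≢ p → ℓ w ≢ suc p → ℓ w ≢ suc (suc p) → inFrom E ℓ w (suc p) ≡ 0
  inFrom-far {w} {p} ≢p ≢sp ≢ssp = sum-map-zero _ (allFin n) no-edge
    where
    no-edge : ∀ u → (if ℓ u ≡ᵇ suc p then E u w else 0) ≡ 0
    no-edge u with ℓ u ℕₚ.≟ suc p
    ... | no ℓu≢  rewrite ≡ᵇ-false ℓu≢ = refl
    ... | yes ℓu≡ rewrite ≡ᵇ-true ℓu≡ =
      ℕₚ.n≤0⇒n≡0 (ℕₚ.≮⇒≥ λ edge → Sum.[ ≢p , Sum.[ ≢sp , ≢ssp ] ] (edge-layers ℓu≡ edge))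

  inFrom-below : ∀ {w p} → ℓ w ≡ p → w ≢ s → inFrom E ℓ w (suc p) ≡ b p
  inFrom-below {w} {zero}  ℓw≡ w≢s = ⊥-elim (w≢s (ℓ≡0⇒≡sink ℓw≡))
  inFrom-below {w} {suc q} ℓw≡ w≢s = b-in w (suc q) ℓw≡ (s≤s z≤n)

map-+-upTo-suc : ∀ i m → map (i ℕ.+_) (upTo (suc m)) ≡ i ∷ map (suc i ℕ.+_) (upTo m)
map-+-upTo-suc i m = cong₂ _∷_ (ℕₚ.+-identityʳ i) (begin
  map (i ℕ.+_) (applyUpTo suc m) ≡⟨ cong (map (i ℕ.+_)) (sym (map-upTo suc m)) ⟩
  map (i ℕ.+_) (map suc (upTo m))          ≡⟨ sym (map-∘ (upTo m)) ⟩
  map ((i ℕ.+_) ∘ suc) (upTo m)            ≡⟨ map-cong (ℕₚ.+-suc i) (upTo m) ⟩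
  map (suc i ℕ.+_) (upTo m)                ∎)
  where open ≡-Reasoning

range-step : ∀ {i d} → i < d → range i d ≡ i ∷ range (suc i) d
range-step {i} {d} i<d = trans (cong (λ m → map (i ℕ.+_) (upTo (suc m))) (ℕₚ.+-∸-assoc 1 i<d))
                               (map-+-upTo-suc i (suc (d ℕ.∸ suc i)))

range-self : ∀ d → range d d ≡ d ∷ []
range-self d = trans (cong (λ m → map (d ℕ.+_) (upTo (suc m))) (ℕₚ.n∸n≡0 d)) (map-+-upTo-suc d 0)

module _ {n : ℕ} (σ : ℕ → List (Fin n)) where

  U-step : ∀ {i d} → i < d → U σ i d ≡ σ i ++ U σ (suc i) d
  U-step i<d = cong (concat ∘ map σ) (range-step i<d)

  U-self : ∀ d → U σ d d ≡ σ d
  U-self d = trans (cong (concat ∘ map σ) (range-self d)) (++-identityʳ (σ d))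

module Layers {n : ℕ} {E : Mult n} {s : Fin n} {ℓ : Fin n → ℕ} {d : ℕ} {a b c : ℕ → ℕ}
              (R : SinkDistanceRegular E s ℓ d a b c)
              (σ : ℕ → List (Fin n)) (σ↭ : ∀ j → σ j ↭ layer ℓ j) where
  open SinkDistanceRegular R
  open Regularity R
  open Toppling E s

  shed : ℕ → Fin n → ℕ
  shed j w = if ℓ w ≡ᵇ j then outdeg E w else 0

  shed-off : ∀ {j w} → ℓ w ≢ j → + shed j w ≡ + 0
  shed-off {j} {w} ℓw≢j = cong (λ t → + (if t then outdeg E w else 0)) (≡ᵇ-false ℓw≢j)

  inflow-σ : ∀ j w → inflow (σ j) w ≡ inFrom E ℓ w j
  inflow-σ j w = trans (sum-↭ (map⁺ (λ v → E v w) (σ↭ j)))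
                       (sum-map-filterᵇ (λ v → ℓ v ≡ᵇ j) (λ v → E v w) (allFin n))

  outflow-σ : ∀ j w → outflow (σ j) w ≡ shed j w
  outflow-σ j w = begin
    outflow (σ j) w
      ≡⟨ sum-↭ (map⁺ lost (σ↭ j)) ⟩
    sum (map lost (layer ℓ j))
      ≡⟨ sum-map-filterᵇ (λ v → ℓ v ≡ᵇ j) lost (allFin n) ⟩
    sum (map (λ v → if ℓ v ≡ᵇ j then lost v else 0) (allFin n))
      ≡⟨ cong sum (map-cong (λ v → if-swap (ℓ v ≡ᵇ j) (does (w ≟ v)) (outdeg E v)) (allFin n)) ⟩
    sum (map (λ v → if does (w ≟ v) then shed j v else 0) (allFin n))
      ≡⟨ sum-allFin-indicator (shed j) w ⟩
    shed j w ∎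
    where
    open ≡-Reasoning
    lost : Fin n → ℕ
    lost v = if does (w ≟ v) then outdeg E v else 0

  run-σ : ∀ j x w → w ≢ s → run E s (σ j) x w ≡ x w ℤ.+ + inFrom E ℓ w j ℤ.- + shed j w
  run-σ j x w w≢s = trans (run-≢sink (σ j) x w w≢s)
                          (cong₂ (λ i o → x w ℤ.+ + i ℤ.- + o) (inflow-σ j w) (outflow-σ j w))

  run-σ-outside : ∀ j x w → w ≢ s → ℓ w ≢ j → run E s (σ j) x w ≡ x w ℤ.+ + inFrom E ℓ w j
  run-σ-outside j x w w≢s ℓw≢j =
    trans (run-σ j x w w≢s) (trans (cong (ℤ._-_ (x w ℤ.+ + inFrom E ℓ w j)) (shed-off ℓw≢j)) (ℤₚ.+-identityʳ _))

  transfer : ℕ → Fin n → ℤ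
  transfer i w = + b (ℕ.pred i) ℤ.* γ ℓ (ℕ.pred i) w ℤ.- + c i ℤ.* γ ℓ i w

  transfer-beyond : ∀ w → transfer (suc d) w ≡ + 0
  transfer-beyond w rewrite b-d | γ-off ℓ (ℕₚ.<⇒≢ (s≤s (d-max w))) | ℤₚ.*-zeroʳ (+ c (suc d)) = refl

  transfer-first : ∀ {i w} → i ≡ 1 → w ≢ s → transfer i w ≡ ℤ.- (+ c 1 ℤ.* γ ℓ 1 w)
  transfer-first refl w≢s rewrite γ-off ℓ (w≢s ∘ ℓ≡0⇒≡sink) | ℤₚ.*-zeroʳ (+ b 0) = ℤₚ.+-identityˡ _

  balance-from-values : ∀ {p w I O g₀ g₁ g₂} →
    inFrom E ℓ w (suc p) ≡ I → + shed (suc p) w ≡ O →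
    γ ℓ p w ≡ g₀ → γ ℓ (suc p) w ≡ g₁ → γ ℓ (suc (suc p)) w ≡ g₂ →
    + I ℤ.- O ≡ + b p ℤ.* g₀ ℤ.- + c (suc p) ℤ.* g₁ ℤ.- (+ b (suc p) ℤ.* g₁ ℤ.- + c (suc (suc p)) ℤ.* g₂) →
    + inFrom E ℓ w (suc p) ℤ.- + shed (suc p) w ≡ transfer (suc p) w ℤ.- transfer (suc (suc p)) w
  balance-from-values refl refl refl refl refl balanced = balanced

  layer-balance : ∀ p w → w ≢ s →
    + inFrom E ℓ w (suc p) ℤ.- + shed (suc p) w ≡ transfer (suc p) w ℤ.- transfer (suc (suc p)) w
  layer-balance p w w≢s with ℓ w ℕₚ.≟ suc p
  ... | yes at =
    balance-from-values (a-in w (suc p) at (s≤s z≤n)) shed-at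
      (γ-off ℓ (ℕₚ.1+n≢n ∘ trans (sym at))) (γ-on ℓ at) (γ-off ℓ (λ e → ℕₚ.1+n≢n (trans (sym e) at)))
      (at-layer (+ a (suc p)) (+ b p) (+ c (suc p)) (+ b (suc p)) (+ c (suc (suc p))))
    where
    shed-at : + shed (suc p) w ≡ + c (suc p) ℤ.+ + a (suc p) ℤ.+ + b (suc p)
    shed-at = begin
      + shed (suc p) w                            ≡⟨ cong (λ t → + (if t then outdeg E w else 0)) (≡ᵇ-true at) ⟩
      + outdeg E w                                ≡⟨ cong +_ (outdeg-layer at) ⟩
      + (c (suc p) ℕ.+ a (suc p) ℕ.+ b (suc p))   ≡⟨ ℤₚ.pos-+ (c (suc p) ℕ.+ a (suc p)) (b (suc p)) ⟩
      + (c (suc p) ℕ.+ a (suc p)) ℤ.+ + b (suc p) ≡⟨ cong (ℤ._+ + b (suc p)) (ℤₚ.pos-+ (c (suc p)) (a (suc p))) ⟩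
      + c (suc p) ℤ.+ + a (suc p) ℤ.+ + b (suc p) ∎
      where open ≡-Reasoning
    at-layer : ∀ A B C B′ C′ → A ℤ.- (C ℤ.+ A ℤ.+ B′) ≡ B ℤ.* + 0 ℤ.- C ℤ.* + 1 ℤ.- (B′ ℤ.* + 1 ℤ.- C′ ℤ.* + 0)
    at-layer = solve-∀
  ... | no ¬at with ℓ w ℕₚ.≟ p
  ...   | yes below =
    balance-from-values (inFrom-below below w≢s) (shed-off ¬at)
      (γ-on ℓ below) (γ-off ℓ ¬at) (γ-off ℓ (ℕₚ.m≢1+n+m p {1} ∘ trans (sym below)))
      (below-layer (+ b p) (+ c (suc p)) (+ b (suc p)) (+ c (suc (suc p))))
    where
    below-layer : ∀ B C B′ C′ → B ℤ.- + 0 ≡ B ℤ.* + 1 ℤ.- C ℤ.* + 0 ℤ.- (B′ ℤ.* + 0 ℤ.- C′ ℤ.* + 0)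
    below-layer = solve-∀
  ...   | no ¬below with ℓ w ℕₚ.≟ suc (suc p)
  ...     | yes above =
    balance-from-values (c-in w (suc p) above (s≤s z≤n)) (shed-off ¬at)
      (γ-off ℓ ¬below) (γ-off ℓ ¬at) (γ-on ℓ above)
      (above-layer (+ b p) (+ c (suc p)) (+ b (suc p)) (+ c (suc (suc p))))
    where
    above-layer : ∀ B C B′ C′ → C′ ℤ.- + 0 ≡ B ℤ.* + 0 ℤ.- C ℤ.* + 0 ℤ.- (B′ ℤ.* + 0 ℤ.- C′ ℤ.* + 1)
    above-layer = solve-∀
  ...     | no ¬above =
    balance-from-values (inFrom-far ¬below ¬at ¬above) (shed-off ¬at)
      (γ-off ℓ ¬below) (γ-off ℓ ¬at) (γ-off ℓ ¬above)
      (far-layer (+ b p) (+ c (suc p)) (+ b (suc p)) (+ c (suc (suc p))))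
    where
    far-layer : ∀ B C B′ C′ → + 0 ℤ.- + 0 ≡ B ℤ.* + 0 ℤ.- C ℤ.* + 0 ℤ.- (B′ ℤ.* + 0 ℤ.- C′ ℤ.* + 0)
    far-layer = solve-∀

  run-σ-transfer : ∀ i x w → 1 ≤ i → w ≢ s →
    run E s (σ i) x w ≡ x w ℤ.+ (transfer i w ℤ.- transfer (suc i) w)
  run-σ-transfer (suc p) x w _ w≢s =
    trans (run-σ (suc p) x w w≢s) (trans (ℤₚ.+-assoc (x w) _ _) (cong (ℤ._+_ (x w)) (layer-balance p w w≢s)))

  σ-in-layer : ∀ j → All (λ v → ℓ v ≡ j) (σ j)
  σ-in-layer j = All-resp-↭ (↭-sym (σ↭ j))
    (All.map (λ {v} → ℕₚ.≡ᵇ⇒≡ (ℓ v) j) (all-filter (T? ∘ (λ v → ℓ v ≡ᵇ j)) (allFin n)))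

  σ-unique : ∀ j → Unique (σ j)
  σ-unique j = Permₛ.Unique-resp-↭ (setoid (Fin n)) (↭⇒↭ₛ (↭-sym (σ↭ j)))
    (Uniqueₚ.filter⁺ (T? ∘ (λ v → ℓ v ≡ᵇ j)) (Uniqueₚ.allFin⁺ n))

  LayerReady : ℕ → Config E → Set
  LayerReady i x = ∀ v → ℓ v ≡ i → + outdeg E v ℤ.≤ x v

  UpperLayersPrimed : ℕ → Config E → Set
  UpperLayersPrimed i x = ∀ v j → ℓ v ≡ j → i < j → j ≤ d → + outdeg E v ℤ.- + c j ℤ.≤ x v

  LegalWithTransfer : ℕ → Config E → Set
  LegalWithTransfer i x =
    Legal E s (U σ i d) x × (∀ w → w ≢ s → run E s (U σ i d) x w ≡ x w ℤ.+ transfer i w)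

  Legal-σ : ∀ j x → LayerReady j x → Legal E s (σ j) x
  Legal-σ j x ready = Legal-unique (σ j) x (σ-unique j) (All.map (ready _) (σ-in-layer j))

  run-σ-ready : ∀ i x → 1 ≤ i → suc i ≤ d → UpperLayersPrimed i x → LayerReady (suc i) (run E s (σ i) x)
  run-σ-ready i x i≥1 i<d primed v ℓv≡ = begin
    + outdeg E v                                 ≡⟨ sym (minus-plus (+ outdeg E v) (+ c (suc i))) ⟩
    + outdeg E v ℤ.- + c (suc i) ℤ.+ + c (suc i) ≤⟨ ℤₚ.+-monoˡ-≤ (+ c (suc i)) (primed v (suc i) ℓv≡ ℕₚ.≤-refl i<d) ⟩
    x v ℤ.+ + c (suc i)                          ≡⟨ cong (λ k → x v ℤ.+ + k) (sym (c-in v i ℓv≡ i≥1)) ⟩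
    x v ℤ.+ + inFrom E ℓ v i                     ≡⟨ sym (run-σ-outside i x v v≢s (ℕₚ.1+n≢n ∘ trans (sym ℓv≡))) ⟩
    run E s (σ i) x v                            ∎
    where
    open ℤₚ.≤-Reasoning
    v≢s : v ≢ s
    v≢s = 0<ℓ⇒≢sink (subst (0 <_) (sym ℓv≡) (s≤s z≤n))
    minus-plus : ∀ m k → m ℤ.- k ℤ.+ k ≡ m
    minus-plus = solve-∀

  run-σ-primed : ∀ i x → UpperLayersPrimed i x → UpperLayersPrimed (suc i) (run E s (σ i) x)
  run-σ-primed i x primed v j ℓv≡j i+1<j j≤d = begin
    + outdeg E v ℤ.- + c j    ≤⟨ primed v j ℓv≡j i<j j≤d ⟩
    x v                       ≤⟨ ℤₚ.i≤i+j (x v) (+ inFrom E ℓ v i) ⟩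
    x v ℤ.+ + inFrom E ℓ v i  ≡⟨ sym (run-σ-outside i x v v≢s (λ ℓv≡i → ℕₚ.<⇒≢ i<j (trans (sym ℓv≡i) ℓv≡j))) ⟩
    run E s (σ i) x v         ∎
    where
    open ℤₚ.≤-Reasoning
    i<j : i < j
    i<j = ℕₚ.<-trans (ℕₚ.n<1+n i) i+1<j
    v≢s : v ≢ s
    v≢s = 0<ℓ⇒≢sink (subst (0 <_) (sym ℓv≡j) (ℕₚ.≤-trans (s≤s z≤n) i<j))

  U-self-transfer : ∀ x → 1 ≤ d → LayerReady d x → LegalWithTransfer d x
  U-self-transfer x d≥1 ready =
    subst (λ us → Legal E s us x) (sym (U-self σ d)) (Legal-σ d x ready) , formula
    where
    formula : ∀ w → w ≢ s → run E s (U σ d d) x w ≡ x w ℤ.+ transfer d w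
    formula w w≢s = begin
      run E s (U σ d d) x w                          ≡⟨ cong (λ us → run E s us x w) (U-self σ d) ⟩
      run E s (σ d) x w                              ≡⟨ run-σ-transfer d x w d≥1 w≢s ⟩
      x w ℤ.+ (transfer d w ℤ.- transfer (suc d) w)  ≡⟨ cong (λ t → x w ℤ.+ (transfer d w ℤ.- t)) (transfer-beyond w) ⟩
      x w ℤ.+ (transfer d w ℤ.- + 0)                 ≡⟨ cong (ℤ._+_ (x w)) (ℤₚ.+-identityʳ (transfer d w)) ⟩
      x w ℤ.+ transfer d w                           ∎
      where open ≡-Reasoning

  U-step-transfer : ∀ i x → 1 ≤ i → i < d → LayerReady i x →
    LegalWithTransfer (suc i) (run E s (σ i) x) → LegalWithTransfer i x
  U-step-transfer i x i≥1 i<d ready (legal-rest , formula-rest) =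
    subst (λ us → Legal E s us x) (sym (U-step σ i<d)) (Legal-++ (σ i) _ x (Legal-σ i x ready) legal-rest) ,
    formula
    where
    formula : ∀ w → w ≢ s → run E s (U σ i d) x w ≡ x w ℤ.+ transfer i w
    formula w w≢s = begin
      run E s (U σ i d) x w                      ≡⟨ cong (λ us → run E s us x w) (U-step σ i<d) ⟩
      run E s (σ i ++ U σ (suc i) d) x w         ≡⟨ cong (λ y → y w) (run-++ (σ i) (U σ (suc i) d) x) ⟩
      run E s (U σ (suc i) d) (run E s (σ i) x) w ≡⟨ formula-rest w w≢s ⟩
      run E s (σ i) x w ℤ.+ transfer (suc i) w   ≡⟨ cong (λ y → y ℤ.+ transfer (suc i) w) (run-σ-transfer i x w i≥1 w≢s) ⟩
      x w ℤ.+ (transfer i w ℤ.- transfer (suc i) w) ℤ.+ transfer (suc i) w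
                                                 ≡⟨ telescope (x w) (transfer i w) (transfer (suc i) w) ⟩
      x w ℤ.+ transfer i w                       ∎
      where
      open ≡-Reasoning
      telescope : ∀ y t t′ → y ℤ.+ (t ℤ.- t′) ℤ.+ t′ ≡ y ℤ.+ t
      telescope = solve-∀

  U-transfer : ∀ k i x → 1 ≤ i → d ≡ k ℕ.+ i → LayerReady i x → UpperLayersPrimed i x → LegalWithTransfer i x
  U-transfer zero    .d x d≥1 refl ready _      = U-self-transfer x d≥1 ready
  U-transfer (suc k) i  x i≥1 d≡   ready primed =
    U-step-transfer i x i≥1 i<d ready
      (U-transfer k (suc i) (run E s (σ i) x) (s≤s z≤n) (trans d≡ (sym (ℕₚ.+-suc k i)))
        (run-σ-ready i x i≥1 i<d primed) (run-σ-primed i x primed))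
    where
    i<d : i < d
    i<d = subst (i <_) (sym d≡) (s≤s (ℕₚ.m≤n+m i k))

lemma6p6 : (n : ℕ) (E : Mult n) (s : Fin n) (ℓ : Fin n → ℕ) (d : ℕ) (a b c : ℕ → ℕ)
    → SinkDistanceRegular E s ℓ d a b c
    → 1 ≤ d
    → (σ : ℕ → List (Fin n)) → (∀ j → σ j ↭ layer ℓ j)
    → (i : ℕ) → 1 ≤ i → i ≤ d
    → (x : Config E)
    → (∀ v → v ≢ s → + 0 ℤ.≤ x v)
    → (∀ v → ℓ v ≡ i → + outdeg E v ℤ.≤ x v)
    → (∀ v j → ℓ v ≡ j → i < j → j ≤ d → + outdeg E v ℤ.- + c j ℤ.≤ x v)
    → Legal E s (U σ i d) x
      × (1 < i → ∀ w → w ≢ s →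
           run E s (U σ i d) x w ≡ x w ℤ.+ + b (ℕ.pred i) ℤ.* γ ℓ (ℕ.pred i) w ℤ.- + c i ℤ.* γ ℓ i w)
      × (i ≡ 1 → ∀ w → w ≢ s →
           run E s (U σ i d) x w ≡ x w ℤ.- + c 1 ℤ.* γ ℓ 1 w)
lemma6p6 n E s ℓ d a b c R _ σ σ↭ i i≥1 i≤d x _ ready primed =
  legal ,
  (λ _ w w≢s → trans (formula w w≢s) (sym (ℤₚ.+-assoc (x w) _ _))) ,
  (λ i≡1 w w≢s → trans (formula w w≢s) (cong (ℤ._+_ (x w)) (transfer-first i≡1 w≢s)))
  where
  open Layers R σ σ↭
  outcome : LegalWithTransfer i x
  outcome = U-transfer (d ℕ.∸ i) i x i≥1 (sym (ℕₚ.m∸n+n≡m i≤d)) ready primed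
  legal : Legal E s (U σ i d) x
  legal = proj₁ outcome
  formula : ∀ w → w ≢ s → run E s (U σ i d) x w ≡ x w ℤ.+ transfer i w
  formula = proj₂ outcome
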